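{- Let $G$ be a connected graph and let $S_e$ and $S_f$ be equivalence classes of $\mathcal{C}_G$. If $V(S_e)\setminus V(S_f)$, $V(S_f)\setminus V(S_e)$ and $V(S_e)\cap V(S_f)$ are all nonempty, then every edge in $S_e$ and every edge in $S_f$ has an endpoint in $V(S_e)\cap V(S_f)$.
   Context: A quasi-transitive $2$-edge-colouring of a graph $G$ is a map $c: E(G)\to\{R,B\}$ such that for all pairs of edges $xy, yz \in E(G)$ with $c(xy)\neq c(yz)$, we have $xz\in E(G)$. $\mathcal{C}_G$ is the equivalence relation on $E(G)$ with $e\sim f$ iff $c(e)=c(f)$ for every quasi-transitive $2$-edge-colouring $c$ of $G$. For a set of edges $E$, $V(E)$ denotes the set of endpoints of edges in $E$. -}

module Defs where

open import Data.Nat using (ℕ)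
open import Data.Fin using (Fin)
open import Data.Bool using (Bool; true; false)
open import Data.Product using (Σ; _×_; _,_; ∃-syntax)
open import Data.Sum using (_⊎_)
open import Relation.Binary.PropositionalEquality using (_≡_; _≢_)
open import Relation.Nullary using (¬_)

record Graph : Set where
  field
    n     : ℕ
    adj   : Fin n → Fin n → Bool
    sym   : ∀ x y → adj x y ≡ adj y x
    irrefl : ∀ x → adj x x ≡ false

open Graph public

module _ (G : Graph) where

  Vertex : Set
  Vertex = Fin (n G)

  Adj : Vertex → Vertex → Set
  Adj x y = adj G x y ≡ true

  -- An edge, represented by an ordered pair of its endpoints
  -- (xy and yx denote the same edge; all notions below respect this).
  Edge : Set
  Edge = Σ Vertex λ x → Σ Vertex λ y → Adj x y

  _∈ₑ_ : Vertex → Edge → Set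
  v ∈ₑ (x , y , _) = (v ≡ x) ⊎ (v ≡ y)

  data Reach : Vertex → Vertex → Set where
    here : ∀ {x} → Reach x x
    step : ∀ {x y z} → Adj x y → Reach y z → Reach x z

  Connected : Set
  Connected = ∀ x y → Reach x y

data Colour : Set where
  R B : Colour

module _ (G : Graph) where

  -- A 2-edge-colouring: a colour for each ordered pair, symmetric on edges,
  -- so it is a map on the (unordered) edges of G.
  record EdgeColouring : Set where
    field
      col    : Vertex G → Vertex G → Colour
      colSym : ∀ x y → Adj G x y → col x y ≡ col y x

  colourOf : EdgeColouring → Edge G → Colour
  colourOf c (x , y , _) = EdgeColouring.col c x y

  QuasiTransitive : EdgeColouring → Set
  QuasiTransitive c = ∀ x y z → Adj G x y → Adj G y z →
    EdgeColouring.col c x y ≢ EdgeColouring.col c y z → Adj G x z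

  _∼C_ : Edge G → Edge G → Set
  e ∼C f = ∀ (c : EdgeColouring) → QuasiTransitive c → colourOf c e ≡ colourOf c f

  InVClass : Edge G → Vertex G → Set
  InVClass e v = ∃[ g ] (g ∼C e × _∈ₑ_ G v g)

module Submission where

-- A decidable relation Q on oriented pairs that is closed under forcing (xy forces yx, and
-- yz whenever xz is a non-edge) yields a quasi-transitive colouring, red exactly on Q; so
-- every 𝒞_G-class lies inside Q or misses it. Taking Q to be the forcing closure of e shows
-- that 𝒞_G is decidable, and taking Q to be "in S_e with both ends adjacent to v" shows
-- that V(S_e) is a module. If u ∈ V(S_f) ∖ V(S_e), adjacency can be relayed through u, so
-- V(S_e) ∖ V(S_f) is a module too and "both ends in V(S_e) ∖ V(S_f)" is forcing-closed. An
-- edge of S_e with no end in V(S_f) would then drag all of S_e into V(S_e) ∖ V(S_f), which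
-- is impossible since some edge of S_e ends at w ∈ V(S_e) ∩ V(S_f).

open import Level using (Level; 0ℓ)
open import Data.Bool as Bool using (true; if_then_else_)
open import Data.Nat using (ℕ; _*_)
open import Data.Fin using (Fin; _≟_; remQuot; combine)
open import Data.Fin.Properties using (any?; remQuot-combine)
open import Data.Fin.Subset using (Subset; _∈_; _⊆_; _⊃_; _∪_; ⁅_⁆)
open import Data.Fin.Subset.Properties
  using (_∈?_; x∈⁅x⁆; x∈⁅y⁆⇒x≡y; p⊆p∪q; q⊆p∪q; x∈p∪q⁻; ⊆-trans)
open import Data.Fin.Subset.Induction using (⊃-wellFounded; Acc; acc)
open import Data.Product using (Σ-syntax; ∃-syntax; _×_; _,_; proj₁; proj₂; uncurry)
open import Data.Sum using (inj₁; inj₂)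
open import Function using (id; _∘_; _on_)
open import Relation.Binary.Core using (Rel)
open import Relation.Binary.Definitions using (Decidable)
import Relation.Binary.Construct.On as On
open import Relation.Binary.Construct.Closure.ReflexiveTransitive using (Star; ε; _◅_; _◅◅_; fold)
open import Relation.Binary.PropositionalEquality
  using (_≡_; refl; subst; subst₂; sym; trans; cong; module ≡-Reasoning)
open import Relation.Unary using (Pred; _∖_)
import Relation.Unary as U
open import Relation.Unary.Properties using (_∩?_; ∁?)
open import Relation.Nullary using (¬_; yes; no; does; ¬?; contradiction)
open import Relation.Nullary.Decidable using (_×-dec_; _⊎-dec_; decidable-stable)
import Relation.Nullary.Decidable as Dec

open import Defs hiding (sym)

module _ {m : ℕ} {ℓ : Level} {R : Rel (Fin m) ℓ} where

  private
    ReachableFrom : Fin m → Subset m → Set ℓ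
    ReachableFrom s S = ∀ {a} → a ∈ S → Star R s a

    Closed : Subset m → Set ℓ
    Closed S = ∀ {a b} → a ∈ S → R a b → b ∈ S

    Closed⇒Star-closed : ∀ {S a b} → Closed S → a ∈ S → Star R a b → b ∈ S
    Closed⇒Star-closed closed a∈S ε = a∈S
    Closed⇒Star-closed closed a∈S (r ◅ rs) = Closed⇒Star-closed closed (closed a∈S r) rs

    -- Each round adds the head of an edge leaving S, so the recursion is on ⊃.
    closure : Decidable R → ∀ {s} (S : Subset m) → Acc _⊃_ S → ReachableFrom s S →
              Σ[ T ∈ Subset m ] S ⊆ T × ReachableFrom s T × Closed T
    closure R? S (acc rec) reach
      with any? (λ a → any? (λ b → a ∈? S ×-dec R? a b ×-dec ¬? (b ∈? S)))
    ... | no ¬leaving = S , id , reach ,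
          λ {a} {b} a∈S r → decidable-stable (b ∈? S) (λ b∉S → ¬leaving (a , b , a∈S , r , b∉S))
    ... | yes (a , b , a∈S , r , b∉S) =
      let T , S∪b⊆T , reachT , closedT = closure R? (S ∪ ⁅ b ⁆) (rec S⊂S∪b) reach′
      in  T , ⊆-trans (p⊆p∪q ⁅ b ⁆) S∪b⊆T , reachT , closedT
      where
        S⊂S∪b : (S ∪ ⁅ b ⁆) ⊃ S
        S⊂S∪b = p⊆p∪q ⁅ b ⁆ , b , q⊆p∪q S ⁅ b ⁆ (x∈⁅x⁆ b) , b∉S

        reach′ : ReachableFrom _ (S ∪ ⁅ b ⁆)
        reach′ x∈ with x∈p∪q⁻ S ⁅ b ⁆ x∈
        ... | inj₁ x∈S = reach x∈S
        ... | inj₂ x∈b = subst (Star R _) (sym (x∈⁅y⁆⇒x≡y b x∈b)) (reach a∈S ◅◅ r ◅ ε)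

  Star? : Decidable R → Decidable (Star R)
  Star? R? s t
    with closure R? ⁅ s ⁆ (⊃-wellFounded ⁅ s ⁆) (λ x∈ → subst (Star R s) (sym (x∈⁅y⁆⇒x≡y s x∈)) ε)
  ... | T , s⊆T , reachT , closedT with t ∈? T
  ...   | yes t∈T = yes (reachT t∈T)
  ...   | no t∉T = no (t∉T ∘ Closed⇒Star-closed closedT (s⊆T (x∈⁅x⁆ s)))

module _ (G : Graph) where

  private
    V : Set
    V = Vertex G

    _∼_ : Edge G → Edge G → Set
    _∼_ = _∼C_ G

  Adj-sym : ∀ {x y} → Adj G x y → Adj G y x
  Adj-sym {x} {y} xy = trans (Graph.sym G y x) xy

  Adj? : Decidable (Adj G)
  Adj? x y = adj G x y Bool.≟ true

  ends : Edge G → V × V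
  ends (x , y , _) = x , y

  ∈ₑ-both : ∀ {P : V → Set} {v} (g : Edge G) → P (proj₁ (ends g)) → P (proj₂ (ends g)) →
    _∈ₑ_ G v g → P v
  ∈ₑ-both (x , y , _) px py (inj₁ refl) = px
  ∈ₑ-both (x , y , _) px py (inj₂ refl) = py

  ∼C-sym : ∀ {g h} → g ∼ h → h ∼ g
  ∼C-sym g∼h c qt = sym (g∼h c qt)

  ∼C-trans : ∀ {g h k} → g ∼ h → h ∼ k → g ∼ k
  ∼C-trans g∼h h∼k c qt = trans (g∼h c qt) (h∼k c qt)

  data Forces : Rel (V × V) 0ℓ where
    reverse : ∀ {x y} → Adj G x y → Forces (x , y) (y , x)
    forward : ∀ {x y z} → Adj G x y → Adj G y z → ¬ Adj G x z → Forces (x , y) (y , z)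

  Forces? : Decidable Forces
  Forces? (x , y) (y′ , z) with y′ ≟ y
  ... | no y′≢y = no λ { (reverse _) → y′≢y refl ; (forward _ _ _) → y′≢y refl }
  ... | yes refl with Adj? x y | Adj? y z | Adj? x z | z ≟ x
  ...   | no ¬xy | _      | _      | _        =
    no λ { (reverse xy) → ¬xy xy ; (forward xy _ _) → ¬xy xy }
  ...   | yes xy | _      | _      | yes refl = yes (reverse xy)
  ...   | yes xy | yes yz | no ¬xz | no _     = yes (forward xy yz ¬xz)
  ...   | yes _  | no ¬yz | _      | no z≢x   =
    no λ { (reverse _) → z≢x refl ; (forward _ yz _) → ¬yz yz }
  ...   | yes _  | _      | yes xz | no z≢x   =
    no λ { (reverse _) → z≢x refl ; (forward _ _ ¬xz) → ¬xz xz }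

  Forces-target-Adj : ∀ {p x y} → Forces p (x , y) → Adj G x y
  Forces-target-Adj (reverse xy)    = Adj-sym xy
  Forces-target-Adj (forward _ yz _) = yz

  Forces⇒sameColour : ∀ (c : EdgeColouring G) → QuasiTransitive G c → ∀ {p q} → Forces p q →
    uncurry (EdgeColouring.col c) p ≡ uncurry (EdgeColouring.col c) q
  Forces⇒sameColour c qt (reverse {x} {y} xy) = EdgeColouring.colSym c x y xy
  Forces⇒sameColour c qt (forward {x} {y} {z} xy yz ¬xz)
    with EdgeColouring.col c x y | EdgeColouring.col c y z | qt x y z xy yz
  ... | R | R | _         = refl
  ... | B | B | _         = refl
  ... | R | B | differ⇒xz = contradiction (differ⇒xz λ ()) ¬xz
  ... | B | R | differ⇒xz = contradiction (differ⇒xz λ ()) ¬xz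

  Forces⇒∼C : ∀ g h → Forces (ends g) (ends h) → g ∼ h
  Forces⇒∼C (_ , _ , _) (_ , _ , _) f c qt = Forces⇒sameColour c qt f

  ForcingClosed : Pred (V × V) 0ℓ → Set
  ForcingClosed Q = ∀ {p q} → Forces p q → Q p → Q q

  module _ {Q : Pred (V × V) 0ℓ} (Q? : U.Decidable Q) (closed : ForcingClosed Q) where

    private
      indicator : V → V → Colour
      indicator x y = if does (Q? (x , y)) then R else B

      indicator-cong : ∀ {p q} → (Q p → Q q) → (Q q → Q p) →
        uncurry indicator p ≡ uncurry indicator q
      indicator-cong {p} {q} to from with Q? p | Q? q
      ... | yes _  | yes _  = refl
      ... | no _   | no _   = refl
      ... | yes qp | no ¬qq = contradiction (to qp) ¬qq
      ... | no ¬qp | yes qq = contradiction (from qq) ¬qp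

    indicatorColouring : EdgeColouring G
    indicatorColouring = record
      { col    = indicator
      ; colSym = λ x y xy → indicator-cong (closed (reverse xy)) (closed (reverse (Adj-sym xy)))
      }

    indicator-quasiTransitive : QuasiTransitive G indicatorColouring
    indicator-quasiTransitive x y z xy yz colours≢ with Adj? x z
    ... | yes xz = xz
    ... | no ¬xz = contradiction (indicator-cong (closed (forward xy yz ¬xz)) backward) colours≢
      where
        backward : Q (y , z) → Q (x , y)
        backward = closed (reverse (Adj-sym xy))
                 ∘ closed (forward (Adj-sym yz) (Adj-sym xy) (¬xz ∘ Adj-sym))
                 ∘ closed (reverse yz)

    ∼C-preserves : ∀ g h → g ∼ h → Q (ends g) → Q (ends h)
    ∼C-preserves g@(x , y , _) h@(x′ , y′ , _) g∼h qg
      with Q? (x , y) | Q? (x′ , y′) | g∼h indicatorColouring indicator-quasiTransitive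
    ... | yes _  | yes qh | _  = qh
    ... | yes _  | no _   | ()
    ... | no ¬qg | _      | _  = contradiction qg ¬qg

  private
    encode : V × V → Fin (n G * n G)
    encode = uncurry combine

    decode : Fin (n G * n G) → V × V
    decode = remQuot (n G)

    decode-encode : ∀ p → decode (encode p) ≡ p
    decode-encode (x , y) = remQuot-combine x y

  -- Reachability along forcing steps, run on Fin (n * n) so that Star? decides it.
  _⇝*_ : Rel (V × V) 0ℓ
  p ⇝* q = Star (Forces on decode) (encode p) (encode q)

  _⇝*?_ : Decidable _⇝*_
  p ⇝*? q = Star? (On.decidable decode Forces Forces?) (encode p) (encode q)

  ⇝*-closed : ∀ p → ForcingClosed (p ⇝*_)
  ⇝*-closed p {q} {q′} f p⇝*q =
    p⇝*q ◅◅ subst₂ Forces (sym (decode-encode q)) (sym (decode-encode q′)) f ◅ ε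

  ⇝*⇒∼C : ∀ g h → ends g ⇝* ends h → g ∼ h
  ⇝*⇒∼C (x , y , _) (x′ , y′ , _) g⇝*h c qt = begin
    colour (x , y)                     ≡⟨ cong colour (decode-encode (x , y)) ⟨
    colour (decode (encode (x , y)))   ≡⟨ fold (λ i j → colour (decode i) ≡ colour (decode j))
                                              (trans ∘ Forces⇒sameColour c qt) refl g⇝*h ⟩
    colour (decode (encode (x′ , y′))) ≡⟨ cong colour (decode-encode (x′ , y′)) ⟩
    colour (x′ , y′)                   ∎
    where
      open ≡-Reasoning
      colour : V × V → Colour
      colour = uncurry (EdgeColouring.col c)

  _∼C?_ : Decidable _∼_
  g ∼C? h with ends h ⇝*? ends g
  ... | yes h⇝*g = yes (∼C-sym {h} {g} (⇝*⇒∼C h g h⇝*g))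
  ... | no ¬h⇝*g = no λ g∼h →
    ¬h⇝*g (∼C-preserves (ends h ⇝*?_) (⇝*-closed (ends h)) h g (∼C-sym {g} {h} g∼h) ε)

  InClass : Edge G → Pred (V × V) 0ℓ
  InClass e (x , y) = Σ[ xy ∈ Adj G x y ] (x , y , xy) ∼ e

  InClass? : ∀ e → U.Decidable (InClass e)
  InClass? e (x , y) with Adj? x y
  ... | yes xy = Dec.map′ (xy ,_) proj₂ ((x , y , xy) ∼C? e)
  ... | no ¬xy = no (¬xy ∘ proj₁)

  InClass-closed : ∀ e → ForcingClosed (InClass e)
  InClass-closed e {x , y} {x′ , y′} f (xy , g∼e) =
    x′y′ , ∼C-trans {h} {g} {e} (∼C-sym {g} {h} (Forces⇒∼C g h f)) g∼e
    where
      x′y′ = Forces-target-Adj f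
      g = x , y , xy
      h = x′ , y′ , x′y′

  InVClass? : ∀ e → U.Decidable (InVClass G e)
  InVClass? e v = Dec.map′
    (λ (x , y , (xy , g∼e) , v∈g) → (x , y , xy) , g∼e , v∈g)
    (λ ((x , y , xy) , g∼e , v∈g) → x , y , (xy , g∼e) , v∈g)
    (any? λ x → any? λ y → InClass? e (x , y) ×-dec (v ≟ x ⊎-dec v ≟ y))

  IsModule : Pred V 0ℓ → Set
  IsModule M = ∀ {v x y} → ¬ M v → M x → M y → Adj G v x → Adj G v y

  module _ (e : Edge G) {v : V} (v∉ : ¬ InVClass G e v) where

    Adj-along-class-edge : ∀ {x y} (xy : Adj G x y) → (x , y , xy) ∼ e → Adj G v x → Adj G v y
    Adj-along-class-edge {x} {y} xy g∼e vx with Adj? v y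
    ... | yes vy = vy
    ... | no ¬vy = contradiction (h , h∼e , inj₁ refl) v∉
      where
        g = x , y , xy
        h = v , x , vx
        h∼e = ∼C-trans {h} {g} {e} (Forces⇒∼C h g (forward vx xy ¬vy)) g∼e

    Adj-class-edge-ends : ∀ {w x y} (xy : Adj G x y) → (x , y , xy) ∼ e → _∈ₑ_ G w (x , y , xy) →
      Adj G v w → Adj G v x × Adj G v y
    Adj-class-edge-ends {w} {x} {y} xy g∼e =
      ∈ₑ-both {P = λ w → Adj G v w → Adj G v x × Adj G v y} g
        (λ vx → vx , Adj-along-class-edge xy g∼e vx)
        (λ vy → Adj-along-class-edge (Adj-sym xy) g′∼e vy , vy)
      where
        g = x , y , xy
        g′ = y , x , Adj-sym xy
        g′∼e = ∼C-trans {g′} {g} {e} (Forces⇒∼C g′ g (reverse (Adj-sym xy))) g∼e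

  InVClass-isModule : ∀ e → IsModule (InVClass G e)
  InVClass-isModule e {v} v∉ (g@(x₁ , x₂ , x₁x₂) , g∼e , x∈g) (h@(y₁ , y₂ , _) , h∼e , y∈h) vx =
    ∈ₑ-both h (proj₁ (proj₂ Qh)) (proj₂ (proj₂ Qh)) y∈h
    where
      Q : Pred (V × V) 0ℓ
      Q (p , q) = InClass e (p , q) × Adj G v p × Adj G v q

      Q? : U.Decidable Q
      Q? (p , q) = InClass? e (p , q) ×-dec Adj? v p ×-dec Adj? v q

      Q-closed : ForcingClosed Q
      Q-closed f@(reverse _) (c , vp , vq) = InClass-closed e f c , vq , vp
      Q-closed f@(forward _ _ _) (c , vp , vq) = let c′ = InClass-closed e f c in
        c′ , vq , Adj-along-class-edge e v∉ (proj₁ c′) (proj₂ c′) vq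

      Qh : Q (ends h)
      Qh = ∼C-preserves Q? Q-closed g h (∼C-trans {g} {e} {h} g∼e (∼C-sym {h} {e} h∼e))
             ((x₁x₂ , g∼e) , Adj-class-edge-ends e v∉ x₁x₂ g∼e x∈g vx)

  ∖-isModule : ∀ e f {u} → InVClass G f u → ¬ InVClass G e u →
    IsModule (InVClass G e ∖ InVClass G f)
  ∖-isModule e f {u} fu eu∉ {z} {x} {y} z∉ (ex , fx∉) (ey , fy∉) zx with InVClass? e z
  ... | no ez∉ = InVClass-isModule e ez∉ ex ey zx
  ... | yes ez = Adj-sym yz
    where
      fz : InVClass G f z
      fz = decidable-stable (InVClass? f z) (λ fz∉ → z∉ (ez , fz∉))
      xu = InVClass-isModule f fx∉ fz fu (Adj-sym zx)
      uy = InVClass-isModule e eu∉ ex ey (Adj-sym xu)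
      yz = InVClass-isModule f fy∉ fu fz (Adj-sym uy)

  class-edge-meets-∩ : ∀ e f →
    ∃[ u ] (InVClass G f u × ¬ InVClass G e u) → ∃[ w ] (InVClass G e w × InVClass G f w) →
    ∀ g → g ∼ e → ∃[ v ] (_∈ₑ_ G v g × InVClass G e v × InVClass G f v)
  class-edge-meets-∩ e f (u , fu , eu∉) (w , (h , h∼e , w∈h) , fw) g@(x , y , _) g∼e
    with InVClass? f x | InVClass? f y
  ... | yes fx | _      = x , inj₁ refl , (g , g∼e , inj₁ refl) , fx
  ... | no _   | yes fy = y , inj₂ refl , (g , g∼e , inj₂ refl) , fy
  ... | no fx∉ | no fy∉ = contradiction fw (proj₂ (∈ₑ-both {P = M} h (proj₁ Qh) (proj₂ Qh) w∈h))
    where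
      M : Pred V 0ℓ
      M = InVClass G e ∖ InVClass G f

      M? : U.Decidable M
      M? = InVClass? e ∩? ∁? (InVClass? f)

      Q : Pred (V × V) 0ℓ
      Q (p , q) = M p × M q

      Q? : U.Decidable Q
      Q? (p , q) = M? p ×-dec M? q

      Q-closed : ForcingClosed Q
      Q-closed (reverse _) (mp , mq) = mq , mp
      Q-closed (forward {z = z} _ yz ¬xz) (mx , my) =
        my , decidable-stable (M? z)
               (λ z∉ → ¬xz (Adj-sym (∖-isModule e f fu eu∉ z∉ my mx (Adj-sym yz))))

      Qh : Q (ends h)
      Qh = ∼C-preserves Q? Q-closed g h (∼C-trans {g} {e} {h} g∼e (∼C-sym {h} {e} h∼e))
             (((g , g∼e , inj₁ refl) , fx∉) , ((g , g∼e , inj₂ refl) , fy∉))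

corollary24 : (G : Graph) → Connected G → (e f : Edge G) →
    (∃[ v ] (InVClass G e v × ¬ InVClass G f v)) →
    (∃[ v ] (InVClass G f v × ¬ InVClass G e v)) →
    (∃[ v ] (InVClass G e v × InVClass G f v)) →
    ((g : Edge G) → _∼C_ G g e →
       ∃[ v ] (_∈ₑ_ G v g × InVClass G e v × InVClass G f v))
    × ((g : Edge G) → _∼C_ G g f →
       ∃[ v ] (_∈ₑ_ G v g × InVClass G e v × InVClass G f v))
corollary24 G _ e f (t , et , ft∉) (u , fu , eu∉) (w , ew , fw) =
  class-edge-meets-∩ G e f (u , fu , eu∉) (w , ew , fw) ,
  λ g g∼f →
    let v , v∈g , fv , ev = class-edge-meets-∩ G f e (t , et , ft∉) (w , fw , ew) g g∼f
    in  v , v∈g , ev , fv
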